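{- Fix $t\in\mathbb{N}$. Let $M$ and $N$ be matroids, neither of which has a coloop. Then $M$ and $N$ have the same configuration if and only if $M^t$ and $N^t$ have the same configuration.
   Context: A cyclic flat of a matroid $M$ is a flat $F$ such that $M|F$ has no coloops; the cyclic flats form a lattice $\mathcal{Z}(M)$ under inclusion, and a matroid is determined by its cyclic flats and their ranks. The configuration of $M$ is the abstract lattice $\mathcal{Z}(M)$ together with the size and rank of the cyclic flat at each lattice element; two matroids have the same configuration if there is a lattice isomorphism between their lattices of cyclic flats preserving sizes and ranks. The $t$-expansion: for each $e\in E(M)$ let $S_e$ be a $t$-element set with $e\in S_e$, the sets $S_e$ pairwise disjoint; for $X\subseteq E(M)$ let $S_X=\bigcup_{e\in X}S_e$. The $t$-expansion $M^t$ is the matroid on $S_{E(M)}$ whose cyclic flats are exactly the sets $S_A$ with $A\in\mathcal{Z}(M)$, with $r_{M^t}(S_A)=t\cdot r_M(A)$. -}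

module Defs where

open import Data.Nat using (ℕ; _+_; _*_; _≤_; _<_)
open import Data.Fin using (Fin; quotient)
open import Data.Fin.Subset using (Subset; ⊤; ⁅_⁆; _∈_; _∉_; _⊆_; _∪_; _∩_; _-_; ∣_∣)
open import Data.Vec using (tabulate; lookup)
open import Data.Product using (Σ; ∃; _×_; proj₁)
open import Relation.Binary.PropositionalEquality using (_≡_)
open import Function.Bundles using (_⇔_)

record Matroid (n : ℕ) : Set where
  field
    rank       : Subset n → ℕ
    rank-≤card : ∀ X → rank X ≤ ∣ X ∣
    rank-mono  : ∀ {X Y} → X ⊆ Y → rank X ≤ rank Y
    rank-submod : ∀ X Y → rank (X ∪ Y) + rank (X ∩ Y) ≤ rank X + rank Y
open Matroid public

IsColoop : ∀ {n} → Matroid n → Fin n → Set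
IsColoop M e = rank M (⊤ - e) < rank M ⊤

HasNoColoop : ∀ {n} → Matroid n → Set
HasNoColoop M = ∀ e → ¬' (IsColoop M e)
  where
  open import Relation.Nullary using () renaming (¬_ to ¬')

IsFlat : ∀ {n} → Matroid n → Subset n → Set
IsFlat M F = ∀ e → e ∉ F → rank M F < rank M (F ∪ ⁅ e ⁆)

-- M|F has no coloops: no e ∈ F is a coloop of the restriction M|F.
RestrictionHasNoColoop : ∀ {n} → Matroid n → Subset n → Set
RestrictionHasNoColoop M F = ∀ e → e ∈ F → rank M (F - e) ≡ rank M F

IsCyclicFlat : ∀ {n} → Matroid n → Subset n → Set
IsCyclicFlat M F = IsFlat M F × RestrictionHasNoColoop M F

CyclicFlat : ∀ {n} → Matroid n → Set
CyclicFlat M = Σ (Subset _) (IsCyclicFlat M)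

-- Same configuration: a lattice isomorphism Z(M) ≅ Z(N) (a bijection
-- preserving and reflecting inclusion, i.e. an order isomorphism of the
-- lattices) preserving the size and rank of each cyclic flat.
record SameConfig {m n : ℕ} (M : Matroid m) (N : Matroid n) : Set where
  field
    to      : CyclicFlat M → CyclicFlat N
    from    : CyclicFlat N → CyclicFlat M
    from∘to : ∀ A → proj₁ (from (to A)) ≡ proj₁ A
    to∘from : ∀ B → proj₁ (to (from B)) ≡ proj₁ B
    to-order : ∀ A A′ → (proj₁ A ⊆ proj₁ A′) ⇔ (proj₁ (to A) ⊆ proj₁ (to A′))
    to-size : ∀ A → ∣ proj₁ (to A) ∣ ≡ ∣ proj₁ A ∣
    to-rank : ∀ A → rank N (proj₁ (to A)) ≡ rank M (proj₁ A)

-- t-expansion ground set: Fin (m * t), where element y lies in the block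
-- S_e for e = quotient t y (blocks of size t, pairwise disjoint).
-- S_X = ⋃_{e ∈ X} S_e.
S[_]_ : ∀ {m} (t : ℕ) → Subset m → Subset (m * t)
S[_]_ {m} t X = tabulate (λ y → lookup X (quotient {m} t y))

record IsExpansion {m : ℕ} (t : ℕ) (M : Matroid m) (Mt : Matroid (m * t)) : Set where
  field
    cyclic-iff : ∀ Y → IsCyclicFlat Mt Y ⇔ ∃ (λ A → IsCyclicFlat M A × Y ≡ S[ t ] A)
    rank-S     : ∀ A → IsCyclicFlat M A → rank Mt (S[ t ] A) ≡ t * rank M A

-- The map A ↦ S_A is an order isomorphism from the cyclic flats of M onto those of
-- M^t which multiplies both sizes and ranks by t. Configuration isomorphisms can be
-- conjugated by such maps, and since multiplication by t ≠ 0 is injective, the sizes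
-- and ranks match up again in either direction.
module Submission where

open import Defs
open import Data.Bool using (true; false)
open import Data.Fin using (Fin; fromℕ<; quotient; combine; splitAt)
open import Data.Fin.Properties using (remQuot-combine)
open import Data.Fin.Subset using (Subset; _∈_; _⊆_; ∣_∣)
open import Data.Fin.Subset.Properties using (⊆-refl; ⊆-reflexive; ⊆-antisym; ∣⊤∣≡n; ∣⊥∣≡0)
open import Data.Nat using (ℕ; suc; _+_; _*_; NonZero; >-nonZero⁻¹)
open import Data.Nat.Properties using (*-cancelˡ-≡; *-zeroʳ; *-suc)
open import Data.Product using (Σ; _,_; proj₁; proj₂)
open import Data.Sum using (inj₁; inj₂)
open import Data.Vec using ([]; _∷_; _++_; tabulate; lookup; replicate)
open import Data.Vec.Properties
  using (lookup∘tabulate; tabulate∘lookup; tabulate-cong; lookup-splitAt; lookup-replicate;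
         []=⇒lookup; lookup⇒[]=)
open import Function using (flip; _∘′_)
open import Function.Bundles using (_⇔_; mk⇔; Equivalence)
open import Function.Definitions using (Injective)
import Function.Properties.Equivalence as ⇔
open import Level using (0ℓ)
open import Relation.Binary.Core using (Rel; _⇒_)
-- Relational composition; its name is spelled with U+037E, not an ASCII semicolon.
open import Relation.Binary.Construct.Composition using (_;_)
open import Relation.Binary.PropositionalEquality

private
  variable
    m n : ℕ

∈-S⇔ : ∀ t {X : Subset m} {y} → (y ∈ S[ t ] X) ⇔ (quotient {m} t y ∈ X)
∈-S⇔ t {X} {y} = mk⇔
  (λ y∈S → lookup⇒[]= _ X (trans (sym (lookup∘tabulate _ y)) ([]=⇒lookup y∈S)))
  (λ q∈X → lookup⇒[]= y _ (trans (lookup∘tabulate _ y) ([]=⇒lookup q∈X)))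

S-mono : ∀ t {A B : Subset m} → A ⊆ B → S[ t ] A ⊆ S[ t ] B
S-mono t A⊆B = Equivalence.from (∈-S⇔ t) ∘′ A⊆B ∘′ Equivalence.to (∈-S⇔ t)

S-reflects-⊆ : ∀ t .{{_ : NonZero t}} {A B : Subset m} → S[ t ] A ⊆ S[ t ] B → A ⊆ B
S-reflects-⊆ {m} t {A} {B} SA⊆SB {x} x∈A =
  subst (_∈ B) quotient-x (Equivalence.to (∈-S⇔ t) (SA⊆SB (Equivalence.from (∈-S⇔ t) x∈A′)))
  where
  first : Fin t
  first = fromℕ< (>-nonZero⁻¹ t)

  quotient-x : quotient {m} t (combine x first) ≡ x
  quotient-x = cong proj₁ (remQuot-combine x first)

  x∈A′ : quotient {m} t (combine x first) ∈ A
  x∈A′ = subst (_∈ A) (sym quotient-x) x∈A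

S-⊆⇔ : ∀ t .{{_ : NonZero t}} {A B : Subset m} → (A ⊆ B) ⇔ (S[ t ] A ⊆ S[ t ] B)
S-⊆⇔ t = mk⇔ (S-mono t) (S-reflects-⊆ t)

S-injective : ∀ t .{{_ : NonZero t}} {A B : Subset m} → S[ t ] A ≡ S[ t ] B → A ≡ B
S-injective t SA≡SB =
  ⊆-antisym (S-reflects-⊆ t (⊆-reflexive SA≡SB)) (S-reflects-⊆ t (⊆-reflexive (sym SA≡SB)))

S-∷ : ∀ t b (X : Subset m) → S[ t ] (b ∷ X) ≡ replicate t b ++ S[ t ] X
S-∷ {m} t b X = begin
  tabulate (λ y → lookup (b ∷ X) (quotient {suc m} t y))  ≡⟨ tabulate-cong blockwise ⟩
  tabulate (lookup (replicate t b ++ S[ t ] X))           ≡⟨ tabulate∘lookup _ ⟩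
  replicate t b ++ S[ t ] X                               ∎
  where
  open ≡-Reasoning
  blockwise : ∀ y → lookup (b ∷ X) (quotient {suc m} t y) ≡ lookup (replicate t b ++ S[ t ] X) y
  blockwise y rewrite lookup-splitAt t (replicate t b) (S[ t ] X) y with splitAt t y
  ... | inj₁ i = sym (lookup-replicate i b)
  ... | inj₂ j = sym (lookup∘tabulate _ j)

∣p++q∣≡∣p∣+∣q∣ : ∀ (p : Subset m) (q : Subset n) → ∣ p ++ q ∣ ≡ ∣ p ∣ + ∣ q ∣
∣p++q∣≡∣p∣+∣q∣ []          q = refl
∣p++q∣≡∣p∣+∣q∣ (true  ∷ p) q = cong suc (∣p++q∣≡∣p∣+∣q∣ p q)
∣p++q∣≡∣p∣+∣q∣ (false ∷ p) q = ∣p++q∣≡∣p∣+∣q∣ p q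

∣S∣≡t*∣X∣ : ∀ t (X : Subset m) → ∣ S[ t ] X ∣ ≡ t * ∣ X ∣
∣S∣≡t*∣X∣ t [] = sym (*-zeroʳ t)
∣S∣≡t*∣X∣ t (b ∷ X) = begin
  ∣ S[ t ] (b ∷ X) ∣                ≡⟨ cong ∣_∣ (S-∷ t b X) ⟩
  ∣ replicate t b ++ S[ t ] X ∣     ≡⟨ ∣p++q∣≡∣p∣+∣q∣ (replicate t b) _ ⟩
  ∣ replicate t b ∣ + ∣ S[ t ] X ∣  ≡⟨ cong (∣ replicate t b ∣ +_) (∣S∣≡t*∣X∣ t X) ⟩
  ∣ replicate t b ∣ + t * ∣ X ∣     ≡⟨ block b ⟩
  t * ∣ b ∷ X ∣                     ∎
  where
  open ≡-Reasoning
  block : ∀ b → ∣ replicate t b ∣ + t * ∣ X ∣ ≡ t * ∣ b ∷ X ∣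
  block true  = trans (cong (_+ t * ∣ X ∣) (∣⊤∣≡n t)) (sym (*-suc t ∣ X ∣))
  block false = cong (_+ t * ∣ X ∣) (∣⊥∣≡0 t)

⊆-resp-≡ : {X X′ Y Y′ : Subset m} → X ≡ X′ → Y ≡ Y′ → (X ⊆ Y) ⇔ (X′ ⊆ Y′)
⊆-resp-≡ refl refl = ⇔.refl

⊆-preserving-cong : {X Y : Subset m} {X′ Y′ : Subset n} →
                    (X ⊆ Y → X′ ⊆ Y′) → (Y ⊆ X → Y′ ⊆ X′) → X ≡ Y → X′ ≡ Y′
⊆-preserving-cong f g refl = ⊆-antisym (f ⊆-refl) (g ⊆-refl)

record CyclicFlatIso (R S : Rel ℕ 0ℓ) (M : Matroid m) (N : Matroid n) : Set where
  field
    to       : CyclicFlat M → CyclicFlat N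
    from     : CyclicFlat N → CyclicFlat M
    from∘to  : ∀ A → proj₁ (from (to A)) ≡ proj₁ A
    to∘from  : ∀ B → proj₁ (to (from B)) ≡ proj₁ B
    to-order : ∀ A A′ → (proj₁ A ⊆ proj₁ A′) ⇔ (proj₁ (to A) ⊆ proj₁ (to A′))
    to-size  : ∀ A → R ∣ proj₁ A ∣ ∣ proj₁ (to A) ∣
    to-rank  : ∀ A → S (rank M (proj₁ A)) (rank N (proj₁ (to A)))

  from-order : ∀ B B′ → (proj₁ B ⊆ proj₁ B′) ⇔ (proj₁ (from B) ⊆ proj₁ (from B′))
  from-order B B′ = ⇔.trans (⊆-resp-≡ (sym (to∘from B)) (sym (to∘from B′)))
                            (⇔.sym (to-order (from B) (from B′)))

  to-cong : ∀ A A′ → proj₁ A ≡ proj₁ A′ → proj₁ (to A) ≡ proj₁ (to A′)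
  to-cong A A′ = ⊆-preserving-cong (Equivalence.to (to-order A A′))
                                   (Equivalence.to (to-order A′ A))

  from-cong : ∀ B B′ → proj₁ B ≡ proj₁ B′ → proj₁ (from B) ≡ proj₁ (from B′)
  from-cong B B′ = ⊆-preserving-cong (Equivalence.to (from-order B B′))
                                     (Equivalence.to (from-order B′ B))

private
  variable
    R R′ S S′ : Rel ℕ 0ℓ
    M N P : Matroid m

iso-sym : CyclicFlatIso R S M N → CyclicFlatIso (flip R) (flip S) N M
iso-sym {R = R} {S = S} {M = M} {N = N} I = record
  { to       = from
  ; from     = to
  ; from∘to  = to∘from
  ; to∘from  = from∘to
  ; to-order = from-order
  ; to-size  = λ B → subst (λ X → R ∣ proj₁ (from B) ∣ ∣ X ∣) (to∘from B) (to-size (from B))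
  ; to-rank  = λ B → subst (λ X → S (rank M (proj₁ (from B))) (rank N X)) (to∘from B)
                            (to-rank (from B))
  }
  where open CyclicFlatIso I

iso-trans : CyclicFlatIso R S M N → CyclicFlatIso R′ S′ N P →
            CyclicFlatIso (R ; R′) (S ; S′) M P
iso-trans I J = record
  { to       = λ A → J.to (I.to A)
  ; from     = λ C → I.from (J.from C)
  ; from∘to  = λ A → trans (I.from-cong _ _ (J.from∘to (I.to A))) (I.from∘to A)
  ; to∘from  = λ C → trans (J.to-cong _ _ (I.to∘from (J.from C))) (J.to∘from C)
  ; to-order = λ A A′ → ⇔.trans (I.to-order A A′) (J.to-order (I.to A) (I.to A′))
  ; to-size  = λ A → _ , I.to-size A , J.to-size (I.to A)
  ; to-rank  = λ A → _ , I.to-rank A , J.to-rank (I.to A)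
  }
  where
  module I = CyclicFlatIso I
  module J = CyclicFlatIso J

sameConfig⇒iso : SameConfig M N → CyclicFlatIso _≡_ _≡_ M N
sameConfig⇒iso C = record
  { to       = to
  ; from     = from
  ; from∘to  = from∘to
  ; to∘from  = to∘from
  ; to-order = to-order
  ; to-size  = λ A → sym (to-size A)
  ; to-rank  = λ A → sym (to-rank A)
  }
  where open SameConfig C

iso⇒sameConfig : R ⇒ _≡_ → S ⇒ _≡_ → CyclicFlatIso R S M N → SameConfig M N
iso⇒sameConfig R⇒≡ S⇒≡ I = record
  { to       = to
  ; from     = from
  ; from∘to  = from∘to
  ; to∘from  = to∘from
  ; to-order = to-order
  ; to-size  = λ A → sym (R⇒≡ (to-size A))
  ; to-rank  = λ A → sym (S⇒≡ (to-rank A))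
  }
  where open CyclicFlatIso I

Graph : (ℕ → ℕ) → Rel ℕ 0ℓ
Graph f a b = f a ≡ b

graph-conjugate⇒≡ : ∀ f → (flip (Graph f) ; _≡_ ; Graph f) ⇒ _≡_
graph-conjugate⇒≡ f (_ , fa≡x , _ , a≡b , fb≡y) = trans (sym fa≡x) (trans (cong f a≡b) fb≡y)

graph-cancel⇒≡ : ∀ {f} → Injective _≡_ _≡_ f → (Graph f ; _≡_ ; flip (Graph f)) ⇒ _≡_
graph-cancel⇒≡ f-inj (_ , fx≡a , _ , a≡b , fy≡b) = f-inj (trans fx≡a (trans a≡b (sym fy≡b)))

module _ (t : ℕ) .{{_ : NonZero t}} {M : Matroid m} {Mt : Matroid (m * t)}
         (E : IsExpansion t M Mt) where
  open IsExpansion E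

  expansion-block : (Y : CyclicFlat Mt) → Σ (CyclicFlat M) (λ A → proj₁ Y ≡ S[ t ] proj₁ A)
  expansion-block (Y , cY) with Equivalence.to (cyclic-iff Y) cY
  ... | A , cA , Y≡SA = (A , cA) , Y≡SA

  expansionIso : CyclicFlatIso (Graph (t *_)) (Graph (t *_)) M Mt
  expansionIso = record
    { to       = λ (A , cA) → S[ t ] A , Equivalence.from (cyclic-iff (S[ t ] A)) (A , cA , refl)
    ; from     = λ Y → proj₁ (expansion-block Y)
    ; from∘to  = λ _ → S-injective t (sym (proj₂ (expansion-block _)))
    ; to∘from  = λ Y → sym (proj₂ (expansion-block Y))
    ; to-order = λ _ _ → S-⊆⇔ t
    ; to-size  = λ (A , _) → sym (∣S∣≡t*∣X∣ t A)
    ; to-rank  = λ (A , cA) → sym (rank-S A cA)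
    }

lemma3p2 : (t : ℕ) → .{{_ : NonZero t}} → {m n : ℕ} (M : Matroid m) (N : Matroid n)
           → HasNoColoop M → HasNoColoop N
           → (Mt : Matroid (m * t)) (Nt : Matroid (n * t))
           → IsExpansion t M Mt → IsExpansion t N Nt
           → SameConfig M N ⇔ SameConfig Mt Nt
lemma3p2 t M N _ _ Mt Nt EM EN = mk⇔ expand contract
  where
  expand : SameConfig M N → SameConfig Mt Nt
  expand C = iso⇒sameConfig (graph-conjugate⇒≡ (t *_)) (graph-conjugate⇒≡ (t *_))
    (iso-trans (iso-sym (expansionIso t EM)) (iso-trans (sameConfig⇒iso C) (expansionIso t EN)))

  contract : SameConfig Mt Nt → SameConfig M N
  contract C = iso⇒sameConfig (graph-cancel⇒≡ t*-injective) (graph-cancel⇒≡ t*-injective)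
    (iso-trans (expansionIso t EM) (iso-trans (sameConfig⇒iso C) (iso-sym (expansionIso t EN))))
    where
    t*-injective : Injective _≡_ _≡_ (t *_)
    t*-injective = *-cancelˡ-≡ _ _ t
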